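{- For all $n\ge1$, $a_{\{0101,0102,0112,0120,0121\}}(n)=(n-1)^2+1$.
   Context: An ascent in an integer sequence $s_1\cdots s_m$ is an index $j$ with $s_j<s_{j+1}$; $\mathrm{asc}(s)$ is the number of ascents. An ascent sequence is a sequence $x_1\cdots x_n$ of nonnegative integers with $x_1=0$ and $x_i\le 1+\mathrm{asc}(x_1\cdots x_{i-1})$ for $i\ge2$. For a sequence $w$, $\mathrm{red}(w)$ replaces the $i$-th smallest distinct letter of $w$ by $i-1$. A pattern (e.g. $0101$, meaning the sequence $(0,1,0,1)$) is a sequence equal to its reduction. A sequence $x$ contains pattern $p=p_1\cdots p_k$ if there are indices $i_1<\cdots<i_k$ with $\mathrm{red}(x_{i_1}\cdots x_{i_k})=p$; otherwise it avoids $p$. For a set of patterns $P$, $\mathcal A_n(P)$ is the set of ascent sequences of length $n$ avoiding every pattern in $P$, and $a_P(n)=|\mathcal A_n(P)|$. -}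

module Defs where

open import Data.Nat using (ℕ; zero; suc; _≤_; _<?_)
open import Data.Nat.Properties using (_≟_)
open import Data.Fin using (Fin; toℕ)
open import Data.List using (List; []; _∷_; length; lookup; take; map; filter; upTo)
open import Data.List.Membership.DecPropositional _≟_ using (_∈?_)
open import Data.List.Membership.Propositional using (_∈_)
open import Data.List.Relation.Unary.All using (All)
open import Data.List.Relation.Unary.Unique.Propositional using (Unique)
open import Data.List.Relation.Binary.Sublist.Propositional using (_⊆_)
open import Data.Product using (Σ; ∃; _×_)
open import Data.Bool using (true; false; if_then_else_)
import Data.Nat
open import Data.Unit using (⊤)
open import Relation.Nullary using (¬_; does)
open import Relation.Binary.PropositionalEquality using (_≡_)
open import Function.Bundles using (_⇔_)

ascFrom : ℕ → List ℕ → ℕ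
ascFrom a [] = 0
ascFrom a (b ∷ s) = (if does (a <? b) then 1 else 0) Data.Nat.+ ascFrom b s

asc : List ℕ → ℕ
asc [] = 0
asc (a ∷ s) = ascFrom a s

-- ascent sequence: x₁ = 0 and x_i ≤ 1 + asc(x₁ ⋯ x_{i-1}) for i ≥ 2
-- (element i of xs is x_{i+2}, whose prefix is take (i+1) (x ∷ xs))
IsAscentSeq : List ℕ → Set
IsAscentSeq [] = ⊤
IsAscentSeq (x ∷ xs) =
  x ≡ 0 × (∀ (i : Fin (length xs)) → lookup xs i ≤ suc (asc (take (suc (toℕ i)) (x ∷ xs))))

red : List ℕ → List ℕ
red w = map (λ a → length (filter (λ b → b ∈? w) (upTo a))) w

Contains : List ℕ → List ℕ → Set
Contains x p = ∃ λ (s : List ℕ) → s ⊆ x × red s ≡ p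

Avoids : List ℕ → List ℕ → Set
Avoids x p = ¬ Contains x p

InA : ℕ → List (List ℕ) → List ℕ → Set
InA n P x = length x ≡ n × IsAscentSeq x × All (Avoids x) P

-- "the set {x | Q x} of lists is finite with exactly k elements":
-- there is a duplicate-free list enumerating exactly the x with Q x, of length k
HasCard : (List ℕ → Set) → ℕ → Set
HasCard Q k = Σ (List (List ℕ)) λ L → Unique L × (∀ x → (x ∈ L) ⇔ Q x) × length L ≡ k

{-# OPTIONS --safe #-}
-- Read letter by letter, every sequence of the class has prefixes of the shapes
-- 0^(a+1), the staircases 0^(a+1) 1 2 ⋯ h h^j, and the valleys 0^(a+1) 1^(b+1) 0^(c+1).
-- The ascent condition allows at most h + 1 after a staircase of height h. Its top may
-- always be repeated; h + 1 may follow only while the top is unrepeated (else 0112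
-- appears); a smaller letter may follow only if it is 0 and h = 1 (else 0120 or 0121
-- appears). After a valley only 0 may follow (1 and 2 create 0101 and 0102).
-- Conversely these words avoid all five patterns: the binary ones reduce every
-- subsequence to a binary word and contain no 0101, and the staircases are weakly
-- increasing and repeat only 0 and their top. The number of continuations of length m is
-- 1 from a valley or a repeated staircase of height at least 2, 2m + 1 from 0^(a+1) 1,
-- m + 1 from the other staircases and m² + 1 from 0^(a+1); take m = n − 1 from 0.
module Submission where

open import Defs
open import Data.Nat using (ℕ; suc; _∸_; _^_; _+_; _≥_)
open import Data.List using (List; []; _∷_)

open import Data.Nat using (_*_; zero; _≤_; _<_; _≤′_; _<?_; z≤n; s≤s; z<s; s<s; ≤′-refl; ≤′-step)
open import Data.Nat.ListAction using (sum)
open import Data.Nat.Properties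
open import Data.Nat.Tactic.RingSolver using (solve-∀)
open import Data.Bool using (if_then_else_)
open import Data.Fin using (Fin; toℕ) renaming (zero to fzero; suc to fsuc)
open import Data.List using (map; concatMap; lookup; take; length; filter; upTo; applyUpTo; replicate; _++_; [_]; _∷ʳ_)
open import Data.List.Properties
  using (∷-injectiveˡ; ∷-injectiveʳ; ∷ʳ-++; ++-assoc; ++-identityʳ; applyUpTo-∷ʳ; upTo-∷ʳ; length-++; length-map;
         filter-++; filter-accept; filter-reject; length-filter; length-upTo)
open import Data.List.Membership.DecPropositional _≟_ using (_∈?_)
open import Data.List.Membership.Propositional using (_∈_; _∉_; find; lose)
open import Data.List.Membership.Propositional.Properties using (∈-applyUpTo⁺; ∈-map⁺; ∈-map⁻; ∈-concatMap⁺; ∈-concatMap⁻)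
open import Data.List.Relation.Binary.Disjoint.Propositional using (Disjoint)
import Data.List.Relation.Binary.Sublist.Propositional as Sublist
open import Data.List.Relation.Binary.Sublist.Propositional using (_⊆_; []; _∷_; ⊆-refl; ⊆-trans; minimum; to∈; from∈)
open import Data.List.Relation.Binary.Sublist.Propositional.Properties using (All-resp-⊆; ∷ˡ⁻; ++⁺; ++⁺ˡ; ++⁺ʳ)
open import Data.List.Relation.Unary.All as All using (All; []; _∷_)
import Data.List.Relation.Unary.All.Properties as All
open import Data.List.Relation.Unary.AllPairs as AllPairs using (AllPairs; []; _∷_; allPairs?)
import Data.List.Relation.Unary.AllPairs.Properties as AllPairs
open import Data.List.Relation.Unary.Any using (here; there)
open import Data.List.Relation.Unary.Unique.Propositional using (Unique)
import Data.List.Relation.Unary.Unique.Propositional.Properties as Unique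
open import Data.Product using (_×_; _,_; proj₁; ∃; ∃₂)
open import Data.Sum as Sum using (_⊎_; inj₁; inj₂; [_,_]′)
open import Data.Unit using (⊤; tt)
open import Function using (_∘_)
open import Function.Bundles using (_⇔_; mk⇔; Equivalence)
open import Relation.Binary.Definitions using (tri<; tri≈; tri>)
open import Relation.Binary.PropositionalEquality
  using (_≡_; _≢_; refl; sym; trans; cong; cong₂; subst; subst₂; module ≡-Reasoning)
open import Relation.Nullary using (¬_; does; yes; no; contradiction)
open import Relation.Nullary.Decidable using (True; False; toWitness; toWitnessFalse; dec-true; dec-false)

-- red s is map (rank s) s.
rank : List ℕ → ℕ → ℕ
rank s a = length (filter (_∈? s) (upTo a))

rank-suc : ∀ s a → rank s (suc a) ≡ rank s a + length (filter (_∈? s) [ a ])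
rank-suc s a = begin
  length (filter (_∈? s) (upTo (suc a)))                    ≡⟨ cong (length ∘ filter (_∈? s)) (upTo-∷ʳ a) ⟨
  length (filter (_∈? s) (upTo a ∷ʳ a))                     ≡⟨ cong length (filter-++ (_∈? s) (upTo a) [ a ]) ⟩
  length (filter (_∈? s) (upTo a) ++ filter (_∈? s) [ a ])  ≡⟨ length-++ (filter (_∈? s) (upTo a)) ⟩
  rank s a + length (filter (_∈? s) [ a ])                  ∎
  where open ≡-Reasoning

rank-suc-∈ : ∀ {s a} → a ∈ s → rank s (suc a) ≡ suc (rank s a)
rank-suc-∈ {s} {a} a∈s = begin
  rank s (suc a)                            ≡⟨ rank-suc s a ⟩
  rank s a + length (filter (_∈? s) [ a ])  ≡⟨ cong (λ l → rank s a + length l) (filter-accept (_∈? s) a∈s) ⟩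
  rank s a + 1                              ≡⟨ +-comm (rank s a) 1 ⟩
  suc (rank s a)                            ∎
  where open ≡-Reasoning

rank-suc-∉ : ∀ {s a} → a ∉ s → rank s (suc a) ≡ rank s a
rank-suc-∉ {s} {a} a∉s = begin
  rank s (suc a)                            ≡⟨ rank-suc s a ⟩
  rank s a + length (filter (_∈? s) [ a ])  ≡⟨ cong (λ l → rank s a + length l) (filter-reject (_∈? s) a∉s) ⟩
  rank s a + 0                              ≡⟨ +-identityʳ (rank s a) ⟩
  rank s a                                  ∎
  where open ≡-Reasoning

rank-mono : ∀ s {a b} → a ≤ b → rank s a ≤ rank s b
rank-mono s = go ∘ ≤⇒≤′
  where
  go : ∀ {a b} → a ≤′ b → rank s a ≤ rank s b
  go ≤′-refl = ≤-refl
  go (≤′-step {b} a≤′b) = ≤-trans (go a≤′b) (≤-trans (m≤m+n (rank s b) _) (≤-reflexive (sym (rank-suc s b))))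

rank-strict : ∀ {s a b} → a ∈ s → a < b → rank s a < rank s b
rank-strict {s} a∈s a<b = ≤-trans (≤-reflexive (sym (rank-suc-∈ a∈s))) (rank-mono s a<b)

rank-reflects-< : ∀ s {a b} → rank s a < rank s b → a < b
rank-reflects-< s {a} {b} r with a <? b
... | yes a<b = a<b
... | no a≮b = contradiction (rank-mono s (≮⇒≥ a≮b)) (<⇒≱ r)

rank-injective : ∀ {s} a b → a ∈ s → b ∈ s → rank s a ≡ rank s b → a ≡ b
rank-injective a b a∈s b∈s r with <-cmp a b
... | tri< a<b _ _ = contradiction r (<⇒≢ (rank-strict a∈s a<b))
... | tri≈ _ a≡b _ = a≡b
... | tri> _ _ b<a = contradiction r (>⇒≢ (rank-strict b∈s b<a))

rank-≤ : ∀ s a → rank s a ≤ a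
rank-≤ s a = ≤-trans (length-filter (_∈? s) (upTo a)) (≤-reflexive (length-upTo a))

rank-gap : ∀ {s a b} → a ≤ b → All (λ x → x < a ⊎ b ≤ x) s → rank s b ≡ rank s a
rank-gap {s} {a} = go ∘ ≤⇒≤′
  where
  go : ∀ {b} → a ≤′ b → All (λ x → x < a ⊎ b ≤ x) s → rank s b ≡ rank s a
  go ≤′-refl _ = refl
  go (≤′-step {b} a≤′b) outside = trans (rank-suc-∉ b∉s) (go a≤′b (All.map (Sum.map₂ (≤-trans (n≤1+n b))) outside))
    where
    b∉s : b ∉ s
    b∉s b∈s = [ (λ b<a → <⇒≱ b<a (≤′⇒≤ a≤′b)) , 1+n≰n ]′ (All.lookup outside b∈s)

ranks-of-0<y<z : ∀ {s y z} → 0 < y → y < z → All (λ x → x ≡ 0 ⊎ x ≡ y ⊎ x ≡ z) s → 0 ∈ s → y ∈ s →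
                 rank s y ≡ 1 × rank s z ≡ 2
ranks-of-0<y<z {s} {y} {z} 0<y y<z letters 0∈s y∈s = rank-y , rank-z
  where
  rank-y : rank s y ≡ 1
  rank-y = trans (rank-gap 0<y (All.map below-1 letters)) (rank-suc-∈ 0∈s)
    where
    below-1 : ∀ {x} → x ≡ 0 ⊎ x ≡ y ⊎ x ≡ z → x < 1 ⊎ y ≤ x
    below-1 (inj₁ refl)        = inj₁ z<s
    below-1 (inj₂ (inj₁ refl)) = inj₂ ≤-refl
    below-1 (inj₂ (inj₂ refl)) = inj₂ (<⇒≤ y<z)
  rank-z : rank s z ≡ 2
  rank-z = trans (rank-gap y<z (All.map below-1+y letters)) (trans (rank-suc-∈ y∈s) (cong suc rank-y))
    where
    below-1+y : ∀ {x} → x ≡ 0 ⊎ x ≡ y ⊎ x ≡ z → x < suc y ⊎ z ≤ x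
    below-1+y (inj₁ refl)        = inj₁ z<s
    below-1+y (inj₂ (inj₁ refl)) = inj₁ ≤-refl
    below-1+y (inj₂ (inj₂ refl)) = inj₂ ≤-refl

red-0yz0 : ∀ {y z} → 0 < y → y < z → red (0 ∷ y ∷ z ∷ 0 ∷ []) ≡ 0 ∷ 1 ∷ 2 ∷ 0 ∷ []
red-0yz0 0<y y<z
  with ranks-of-0<y<z 0<y y<z (inj₁ refl ∷ inj₂ (inj₁ refl) ∷ inj₂ (inj₂ refl) ∷ inj₁ refl ∷ []) (here refl) (there (here refl))
... | ry , rz = cong₂ (λ p q → 0 ∷ p ∷ q ∷ 0 ∷ []) ry rz

red-0yzy : ∀ {y z} → 0 < y → y < z → red (0 ∷ y ∷ z ∷ y ∷ []) ≡ 0 ∷ 1 ∷ 2 ∷ 1 ∷ []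
red-0yzy 0<y y<z
  with ranks-of-0<y<z 0<y y<z (inj₁ refl ∷ inj₂ (inj₁ refl) ∷ inj₂ (inj₂ refl) ∷ inj₂ (inj₁ refl) ∷ []) (here refl) (there (here refl))
... | ry , rz = cong₂ (λ p q → 0 ∷ p ∷ q ∷ p ∷ []) ry rz

red-0yyz : ∀ {y z} → 0 < y → y < z → red (0 ∷ y ∷ y ∷ z ∷ []) ≡ 0 ∷ 1 ∷ 1 ∷ 2 ∷ []
red-0yyz 0<y y<z
  with ranks-of-0<y<z 0<y y<z (inj₁ refl ∷ inj₂ (inj₁ refl) ∷ inj₂ (inj₁ refl) ∷ inj₂ (inj₂ refl) ∷ []) (here refl) (there (here refl))
... | ry , rz = cong₂ (λ p q → 0 ∷ p ∷ p ∷ q ∷ []) ry rz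

AllPairs-resp-⊆ : ∀ {R : ℕ → ℕ → Set} {xs ys} → xs ⊆ ys → AllPairs R ys → AllPairs R xs
AllPairs-resp-⊆ []               []         = []
AllPairs-resp-⊆ (_ Sublist.∷ʳ τ) (_ ∷ Rys)  = AllPairs-resp-⊆ τ Rys
AllPairs-resp-⊆ (refl ∷ τ)       (Ry ∷ Rys) = All-resp-⊆ τ Ry ∷ AllPairs-resp-⊆ τ Rys

⊆-++-strip : ∀ {x : ℕ} {xs us vs} → x ∉ us → x ∷ xs ⊆ us ++ vs → x ∷ xs ⊆ vs
⊆-++-strip {us = []}     _   τ                  = τ
⊆-++-strip {us = _ ∷ _}  x∉  (_ Sublist.∷ʳ τ)   = ⊆-++-strip (x∉ ∘ there) τ
⊆-++-strip {us = _ ∷ _}  x∉  (refl ∷ _)         = contradiction (here refl) x∉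

∉-replicate : ∀ {x y : ℕ} n → x ≢ y → x ∉ replicate n y
∉-replicate {y = y} n x≢y x∈ = x≢y (All.lookup (All.replicate⁺ {P = _≡ y} n refl) x∈)

replicate-∷ʳ : ∀ n (x : ℕ) → replicate n x ∷ʳ x ≡ replicate (suc n) x
replicate-∷ʳ zero    x = refl
replicate-∷ʳ (suc n) x = cong (x ∷_) (replicate-∷ʳ n x)

++-replicate-∷ʳ : ∀ (u w : List ℕ) n x → u ++ (w ++ replicate (suc n) x) ≡ (u ++ (w ++ replicate n x)) ∷ʳ x
++-replicate-∷ʳ u w n x = begin
  u ++ (w ++ replicate (suc n) x)    ≡⟨ cong (λ r → u ++ (w ++ r)) (replicate-∷ʳ n x) ⟨
  u ++ (w ++ (replicate n x ∷ʳ x))   ≡⟨ cong (u ++_) (++-assoc w (replicate n x) [ x ]) ⟨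
  u ++ ((w ++ replicate n x) ∷ʳ x)   ≡⟨ ++-assoc u (w ++ replicate n x) [ x ] ⟨
  (u ++ (w ++ replicate n x)) ∷ʳ x   ∎
  where open ≡-Reasoning

replicate-sorted : ∀ n {x} → AllPairs _≤_ (replicate n x)
replicate-sorted zero    = []
replicate-sorted (suc n) = All.replicate⁺ n ≤-refl ∷ replicate-sorted n

staircase-increasing : ∀ n → AllPairs _<_ (applyUpTo suc n)
staircase-increasing n = AllPairs.applyUpTo⁺₁ suc n (λ i<j _ → s<s i<j)

repeated-⊆-plateau : ∀ {x us ys} j t → AllPairs _<_ us → x ∷ x ∷ ys ⊆ us ++ replicate j t → All (_≡ t) (x ∷ ys)
repeated-⊆-plateau j t []           τ                = All-resp-⊆ (∷ˡ⁻ τ) (All.replicate⁺ j refl)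
repeated-⊆-plateau j t (_ ∷ us<)    (_ Sublist.∷ʳ τ) = repeated-⊆-plateau j t us< τ
repeated-⊆-plateau j t (u<us ∷ _)   (refl ∷ τ)       =
  All-resp-⊆ (⊆-++-strip (λ u∈us → <-irrefl refl (All.lookup u<us u∈us)) τ) (All.replicate⁺ j refl)

-- Avoiding the five patterns

forbidden : List (List ℕ)
forbidden = (0 ∷ 1 ∷ 0 ∷ 1 ∷ []) ∷ (0 ∷ 1 ∷ 0 ∷ 2 ∷ []) ∷ (0 ∷ 1 ∷ 1 ∷ 2 ∷ []) ∷ (0 ∷ 1 ∷ 2 ∷ 0 ∷ []) ∷ (0 ∷ 1 ∷ 2 ∷ 1 ∷ []) ∷ []

AvoidsAll : List ℕ → Set
AvoidsAll w = All (Avoids w) forbidden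

avoids-⊆ : ∀ {u w} → u ⊆ w → AvoidsAll w → AvoidsAll u
avoids-⊆ u⊆w = All.map (λ ¬occ (s , s⊆u , red≡) → ¬occ (s , ⊆-trans s⊆u u⊆w , red≡))

contains-∷ʳ : ∀ {s w v p} → s ⊆ w → red (s ∷ʳ v) ≡ p → Contains (w ∷ʳ v) p
contains-∷ʳ s⊆w red≡ = _ , ++⁺ s⊆w ⊆-refl , red≡

contains₄ : ∀ {w p q r t} → Contains w (p ∷ q ∷ r ∷ t ∷ []) →
            ∃₂ λ a b → ∃₂ λ c d → let s = a ∷ b ∷ c ∷ d ∷ [] in
            s ⊆ w × rank s a ≡ p × rank s b ≡ q × rank s c ≡ r × rank s d ≡ t
contains₄ (a ∷ b ∷ c ∷ d ∷ [] , s⊆w , refl) = a , b , c , d , s⊆w , refl , refl , refl , refl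
contains₄ ([] , _ , ())
contains₄ (_ ∷ [] , _ , ())
contains₄ (_ ∷ _ ∷ [] , _ , ())
contains₄ (_ ∷ _ ∷ _ ∷ [] , _ , ())
contains₄ (_ ∷ _ ∷ _ ∷ _ ∷ _ ∷ _ , _ , ())

ranks-ordered : ∀ {s} x y {i j} → rank s x ≡ i → rank s y ≡ j → i < j → x < y
ranks-ordered {s} _ _ refl refl i<j = rank-reflects-< s i<j

red-sorted : ∀ {s} → AllPairs _≤_ s → AllPairs _≤_ (red s)
red-sorted {s} = AllPairs.map⁺ ∘ AllPairs.map (rank-mono s)

red-binary : ∀ {s} → All (_≤ 1) s → All (_≤ 1) (red s)
red-binary {s} = All.map⁺ ∘ All.map (λ {x} x≤1 → ≤-trans (rank-≤ s x) x≤1)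

binary-< : ∀ {x y} → x < y → y ≤ 1 → x ≡ 0 × y ≡ 1
binary-< (s≤s z≤n) (s≤s z≤n) = refl , refl

binary-avoids : ∀ {w} → All (_≤ 1) w → ¬ (0 ∷ 1 ∷ 0 ∷ 1 ∷ []) ⊆ w → AvoidsAll w
binary-avoids {w} w≤1 ¬0101⊆w = avoid-0101 ∷ has-2 ∷ has-2 ∷ has-2 ∷ has-2 ∷ []
  where
  avoid-0101 : Avoids w (0 ∷ 1 ∷ 0 ∷ 1 ∷ [])
  avoid-0101 occ with contains₄ occ
  ... | a , b , c , d , s⊆w , ra , rb , rc , rd with All-resp-⊆ s⊆w w≤1
  ... | _ ∷ b≤1 ∷ _ ∷ d≤1 ∷ []
    with binary-< (ranks-ordered a b ra rb z<s) b≤1 | binary-< (ranks-ordered c d rc rd z<s) d≤1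
  ... | refl , refl | refl , refl = ¬0101⊆w s⊆w
  has-2 : ∀ {p} {2∈p : True (2 ∈? p)} → Avoids w p
  has-2 {2∈p = 2∈p} (s , s⊆w , refl) with All.lookup (red-binary (All-resp-⊆ s⊆w w≤1)) (toWitness 2∈p)
  ... | s≤s ()

sorted-avoids : ∀ {w} → AllPairs _≤_ w → (∀ {x y} → 0 < x → x ∷ x ∷ y ∷ [] ⊆ w → y ≤ x) → AvoidsAll w
sorted-avoids {w} sorted repeats = unsorted ∷ unsorted ∷ avoid-0112 ∷ unsorted ∷ unsorted ∷ []
  where
  unsorted : ∀ {p} {p-unsorted : False (allPairs? _≤?_ p)} → Avoids w p
  unsorted {p-unsorted = p-unsorted} (s , s⊆w , refl) =
    toWitnessFalse p-unsorted (red-sorted (AllPairs-resp-⊆ s⊆w sorted))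
  avoid-0112 : Avoids w (0 ∷ 1 ∷ 1 ∷ 2 ∷ [])
  avoid-0112 occ with contains₄ occ
  ... | a , b , c , d , s⊆w , ra , rb , rc , rd
    with rank-injective b c (there (here refl)) (there (there (here refl))) (trans rb (sym rc))
  ... | refl = <⇒≱ (ranks-ordered b d rc rd (s<s z<s))
                   (repeats (<-≤-trans z<s (ranks-ordered a b ra rb z<s)) (∷ˡ⁻ s⊆w))

-- Prefix shapes

data State : Set where
  zeros  : (a : ℕ) → State
  stair  : (a k j : ℕ) → State
  valley : (a b c : ℕ) → State

word : State → List ℕ
word (zeros a)      = replicate (suc a) 0
word (stair a k j)  = replicate (suc a) 0 ++ applyUpTo suc (suc k) ++ replicate j (suc k)
word (valley a b c) = replicate (suc a) 0 ++ replicate (suc b) 1 ++ replicate (suc c) 0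

stair-sorted : ∀ a k j → AllPairs _≤_ (word (stair a k j))
stair-sorted a k j =
  AllPairs.++⁺ (replicate-sorted (suc a))
    (AllPairs.++⁺ (AllPairs.map <⇒≤ (staircase-increasing (suc k))) (replicate-sorted j)
      (All.applyUpTo⁺₁ suc (suc k) (λ i<1+k → All.replicate⁺ j i<1+k)))
    (All.replicate⁺ (suc a) (All.universal (λ _ → z≤n) _))

stair-repeats : ∀ a k j {x y} → 0 < x → x ∷ x ∷ y ∷ [] ⊆ word (stair a k j) → y ≤ x
stair-repeats a k j 0<x τ
  with repeated-⊆-plateau j (suc k) (staircase-increasing (suc k)) (⊆-++-strip (∉-replicate (suc a) (>⇒≢ 0<x)) τ)
... | x≡top ∷ y≡top ∷ [] = ≤-reflexive (trans y≡top (sym x≡top))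

valley-no-0101 : ∀ a b c → ¬ (0 ∷ 1 ∷ 0 ∷ 1 ∷ []) ⊆ word (valley a b c)
valley-no-0101 a b c τ =
  ∉-replicate (suc c) (λ ()) (to∈ (∷ˡ⁻ (⊆-++-strip (∉-replicate (suc b) (λ ()))
    (∷ˡ⁻ (⊆-++-strip (∉-replicate (suc a) (λ ())) (∷ˡ⁻ τ))))))

word-avoids : ∀ st → AvoidsAll (word st)
word-avoids (zeros a) =
  binary-avoids (All.replicate⁺ (suc a) z≤n) (λ τ → ∉-replicate (suc a) (λ ()) (to∈ (∷ˡ⁻ τ)))
word-avoids (stair a k j) = sorted-avoids (stair-sorted a k j) (stair-repeats a k j)
word-avoids (valley a b c) =
  binary-avoids
    (All.++⁺ (All.replicate⁺ (suc a) z≤n) (All.++⁺ (All.replicate⁺ (suc b) ≤-refl) (All.replicate⁺ (suc c) z≤n)))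
    (valley-no-0101 a b c)

ascentBit : ℕ → ℕ → ℕ
ascentBit l v = if does (l <? v) then 1 else 0

ascentBit-< : ∀ {l v} → l < v → ascentBit l v ≡ 1
ascentBit-< {l} {v} l<v rewrite dec-true (l <? v) l<v = refl

ascentBit-≥ : ∀ {l v} → v ≤ l → ascentBit l v ≡ 0
ascentBit-≥ {l} {v} v≤l rewrite dec-false (l <? v) (≤⇒≯ v≤l) = refl

-- z can follow a prefix with last letter l and c ascents.
IsAscentTail : ℕ → ℕ → List ℕ → Set
IsAscentTail l c []      = ⊤
IsAscentTail l c (v ∷ z) = v ≤ suc c × IsAscentTail v (c + ascentBit l v) z

IsAscentTail⇔lookup : ∀ l c z →
  IsAscentTail l c z ⇔ (∀ (i : Fin (length z)) → lookup z i ≤ suc (c + ascFrom l (take (toℕ i) z)))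
IsAscentTail⇔lookup l c z = mk⇔ (to l c z) (from l c z)
  where
  to : ∀ l c z → IsAscentTail l c z → ∀ i → lookup z i ≤ suc (c + ascFrom l (take (toℕ i) z))
  to l c (v ∷ z) (v≤ , _)    fzero    = ≤-trans v≤ (≤-reflexive (cong suc (sym (+-identityʳ c))))
  to l c (v ∷ z) (_ , tail)  (fsuc i) =
    ≤-trans (to v (c + ascentBit l v) z tail i) (≤-reflexive (cong suc (+-assoc c (ascentBit l v) _)))
  from : ∀ l c z → (∀ i → lookup z i ≤ suc (c + ascFrom l (take (toℕ i) z))) → IsAscentTail l c z
  from l c []      _       = tt
  from l c (v ∷ z) bounds  =
    ≤-trans (bounds fzero) (≤-reflexive (cong suc (+-identityʳ c))) ,
    from v (c + ascentBit l v) z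
      (λ i → ≤-trans (bounds (fsuc i)) (≤-reflexive (cong suc (sym (+-assoc c (ascentBit l v) _)))))

lastLetter : State → ℕ
lastLetter (zeros _)      = 0
lastLetter (stair _ k _)  = suc k
lastLetter (valley _ _ _) = 0

ascents : State → ℕ
ascents (zeros _)      = 0
ascents (stair _ k _)  = suc k
ascents (valley _ _ _) = 1

descents : ℕ → ℕ → ℕ → List (ℕ × State)
descents a zero    j = (0 , valley a j 0) ∷ []
descents a (suc k) j = []

successors : State → List (ℕ × State)
successors (zeros a)           = (0 , zeros (suc a)) ∷ (1 , stair a 0 0) ∷ []
successors (stair a k zero)    = (suc (suc k) , stair a (suc k) 0) ∷ (suc k , stair a k 1) ∷ descents a k 0
successors (stair a k (suc j)) = (suc k , stair a k (suc (suc j))) ∷ descents a k (suc j)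
successors (valley a b c)      = (0 , valley a b (suc c)) ∷ []

record Transition (st : State) (v : ℕ) (st′ : State) : Set where
  field
    letter-bound : v ≤ suc (ascents st)
    word-∷ʳ      : word st′ ≡ word st ∷ʳ v
    lastLetter≡  : lastLetter st′ ≡ v
    ascents≡     : ascents st′ ≡ ascents st + ascentBit (lastLetter st) v

zeros-0 : ∀ a → Transition (zeros a) 0 (zeros (suc a))
zeros-0 a = record
  { letter-bound = z≤n ; word-∷ʳ = sym (replicate-∷ʳ (suc a) 0) ; lastLetter≡ = refl ; ascents≡ = refl }

zeros-1 : ∀ a → Transition (zeros a) 1 (stair a 0 0)
zeros-1 a = record { letter-bound = ≤-refl ; word-∷ʳ = refl ; lastLetter≡ = refl ; ascents≡ = refl }

stair-rise : ∀ a k → Transition (stair a k 0) (suc (suc k)) (stair a (suc k) 0)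
stair-rise a k = record
  { letter-bound = ≤-refl
  ; word-∷ʳ      = trans (cong (zs ++_) (trans (++-identityʳ (applyUpTo suc (2 + k))) (sym (applyUpTo-∷ʳ suc (suc k)))))
                         (++-replicate-∷ʳ zs (applyUpTo suc (suc k)) 0 (2 + k))
  ; lastLetter≡  = refl
  ; ascents≡     = sym (trans (cong (suc k +_) (ascentBit-< (n<1+n (suc k)))) (+-comm (suc k) 1))
  }
  where zs = replicate (suc a) 0

stair-repeat : ∀ a k j → Transition (stair a k j) (suc k) (stair a k (suc j))
stair-repeat a k j = record
  { letter-bound = n≤1+n (suc k)
  ; word-∷ʳ      = ++-replicate-∷ʳ (replicate (suc a) 0) (applyUpTo suc (suc k)) j (suc k)
  ; lastLetter≡  = refl
  ; ascents≡     = sym (trans (cong (suc k +_) (ascentBit-≥ (≤-refl {suc k}))) (+-identityʳ (suc k)))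
  }

stair-descend : ∀ a j → Transition (stair a 0 j) 0 (valley a j 0)
stair-descend a j = record
  { letter-bound = z≤n
  ; word-∷ʳ      = sym (++-assoc (replicate (suc a) 0) (replicate (suc j) 1) [ 0 ])
  ; lastLetter≡  = refl
  ; ascents≡     = refl
  }

valley-0 : ∀ a b c → Transition (valley a b c) 0 (valley a b (suc c))
valley-0 a b c = record
  { letter-bound = z≤n
  ; word-∷ʳ      = ++-replicate-∷ʳ (replicate (suc a) 0) (replicate (suc b) 1) (suc c) 0
  ; lastLetter≡  = refl
  ; ascents≡     = refl
  }

successor-transition : ∀ st {v st′} → (v , st′) ∈ successors st → Transition st v st′
successor-transition (zeros a)              (here refl)                 = zeros-0 a
successor-transition (zeros a)              (there (here refl))         = zeros-1 a
successor-transition (stair a k zero)       (here refl)                 = stair-rise a k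
successor-transition (stair a k zero)       (there (here refl))         = stair-repeat a k 0
successor-transition (stair a zero zero)    (there (there (here refl))) = stair-descend a 0
successor-transition (stair a k (suc j))    (here refl)                 = stair-repeat a k (suc j)
successor-transition (stair a zero (suc j)) (there (here refl))         = stair-descend a (suc j)
successor-transition (valley a b c)         (here refl)                 = valley-0 a b c

transition-word : ∀ {st v st′} z → Transition st v st′ → word st ++ v ∷ z ≡ word st′ ++ z
transition-word {st} {v} z t =
  trans (sym (∷ʳ-++ (word st) v z)) (cong (_++ z) (sym (Transition.word-∷ʳ t)))

transition-tail : ∀ {st v st′ z} → Transition st v st′ →
                  IsAscentTail (lastLetter st) (ascents st) (v ∷ z) ⇔ IsAscentTail (lastLetter st′) (ascents st′) z
transition-tail {z = z} t = mk⇔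
  (λ (_ , tail) → subst₂ (λ l c → IsAscentTail l c z) (sym lastLetter≡) (sym ascents≡) tail)
  (λ tail → letter-bound , subst₂ (λ l c → IsAscentTail l c z) lastLetter≡ ascents≡ tail)
  where open Transition t

-- Forced transitions

stair-has-0-step-top : ∀ a n j {i} → i < n → 0 ∷ suc i ∷ suc n ∷ [] ⊆ word (stair a n j)
stair-has-0-step-top a n j {i} i<n =
  refl ∷ ++⁺ˡ (replicate a 0) (++⁺ʳ (replicate j (suc n))
    (subst (suc i ∷ suc n ∷ [] ⊆_) (applyUpTo-∷ʳ suc n) (++⁺ (from∈ (∈-applyUpTo⁺ suc i<n)) ⊆-refl)))

stair-has-0-top-top : ∀ a k j → 0 ∷ suc k ∷ suc k ∷ [] ⊆ word (stair a k (suc j))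
stair-has-0-top-top a k j =
  refl ∷ ++⁺ˡ (replicate a 0) (++⁺ (from∈ (∈-applyUpTo⁺ suc (n<1+n k))) (refl ∷ minimum (replicate j (suc k))))

valley-has-010 : ∀ a b c → 0 ∷ 1 ∷ 0 ∷ [] ⊆ word (valley a b c)
valley-has-010 a b c = refl ∷ ++⁺ˡ (replicate a 0) (refl ∷ ++⁺ˡ (replicate b 1) (refl ∷ minimum _))

staircase-no-descent : ∀ a k j {v} → v ≤ suc k → ¬ AvoidsAll (word (stair a (suc k) j) ∷ʳ v)
staircase-no-descent a k j {zero}  _     (_ ∷ _ ∷ _ ∷ ¬0120 ∷ _) =
  ¬0120 (contains-∷ʳ (stair-has-0-step-top a (suc k) j z<s) (red-0yz0 {z = 2 + k} z<s (s<s z<s)))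
staircase-no-descent a k j {suc _} v≤1+k (_ ∷ _ ∷ _ ∷ _ ∷ ¬0121 ∷ _) =
  ¬0121 (contains-∷ʳ (stair-has-0-step-top a (suc k) j v≤1+k) (red-0yzy z<s (s<s v≤1+k)))

plateau-no-rise : ∀ a k j → ¬ AvoidsAll (word (stair a k (suc j)) ∷ʳ suc (suc k))
plateau-no-rise a k j (_ ∷ _ ∷ ¬0112 ∷ _) =
  ¬0112 (contains-∷ʳ (stair-has-0-top-top a k j) (red-0yyz z<s (n<1+n (suc k))))

top-cases : ∀ {v k} → v ≤ suc (suc k) → v ≡ suc (suc k) ⊎ v ≡ suc k ⊎ v ≤ k
top-cases v≤2+k with m≤n⇒m<n∨m≡n v≤2+k
... | inj₂ v≡2+k = inj₁ v≡2+k
... | inj₁ (s≤s v≤1+k) with m≤n⇒m<n∨m≡n v≤1+k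
...   | inj₂ v≡1+k       = inj₂ (inj₁ v≡1+k)
...   | inj₁ (s≤s v≤k)   = inj₂ (inj₂ v≤k)

stair-successor : ∀ a k j {v} → v ≡ suc (suc k) ⊎ v ≡ suc k ⊎ v ≤ k →
                  AvoidsAll (word (stair a k j) ∷ʳ v) → ∃ λ st′ → (v , st′) ∈ successors (stair a k j)
stair-successor a k       zero    (inj₁ refl)         _  = _ , here refl
stair-successor a k       (suc j) (inj₁ refl)         av = contradiction av (plateau-no-rise a k j)
stair-successor a k       zero    (inj₂ (inj₁ refl))  _  = _ , there (here refl)
stair-successor a k       (suc j) (inj₂ (inj₁ refl))  _  = _ , here refl
stair-successor a zero    zero    (inj₂ (inj₂ z≤n))   _  = _ , there (there (here refl))
stair-successor a zero    (suc j) (inj₂ (inj₂ z≤n))   _  = _ , there (here refl)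
stair-successor a (suc k) j       (inj₂ (inj₂ v≤1+k)) av = contradiction av (staircase-no-descent a k j v≤1+k)

transition-exists : ∀ st {v} → v ≤ suc (ascents st) → AvoidsAll (word st ∷ʳ v) →
                    ∃ λ st′ → (v , st′) ∈ successors st
transition-exists (zeros a)      z≤n       _  = _ , here refl
transition-exists (zeros a)      (s≤s z≤n) _  = _ , there (here refl)
transition-exists (stair a k j)  v≤2+k     av = stair-successor a k j (top-cases v≤2+k) av
transition-exists (valley a b c) z≤n       _  = _ , here refl
transition-exists (valley a b c) (s≤s z≤n)       (¬0101 ∷ _) =
  contradiction (contains-∷ʳ (valley-has-010 a b c) refl) ¬0101
transition-exists (valley a b c) (s≤s (s≤s z≤n)) (_ ∷ ¬0102 ∷ _) =
  contradiction (contains-∷ʳ (valley-has-010 a b c) refl) ¬0102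

-- Enumeration and counting

gen : State → ℕ → List (List ℕ)
gen st zero    = [ [] ]
gen st (suc n) = concatMap (λ (v , st′) → map (v ∷_) (gen st′ n)) (successors st)

Continuation : State → ℕ → List ℕ → Set
Continuation st n z = length z ≡ n × IsAscentTail (lastLetter st) (ascents st) z × AvoidsAll (word st ++ z)

gen-sound : ∀ st n {z} → z ∈ gen st n → Continuation st n z
gen-sound st zero    (here refl) = refl , tt , subst AvoidsAll (sym (++-identityʳ (word st))) (word-avoids st)
gen-sound st (suc n) z∈gen
  with (v , st′) , succ , z∈ ← find (∈-concatMap⁻ _ {xs = successors st} z∈gen)
  with z′ , z′∈gen , refl ← ∈-map⁻ (v ∷_) z∈
  with len , tail , avoids ← gen-sound st′ n z′∈gen
  = cong suc len ,
    Equivalence.from (transition-tail t) tail ,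
    subst AvoidsAll (sym (transition-word z′ t)) avoids
  where t = successor-transition st succ

gen-complete : ∀ st z → IsAscentTail (lastLetter st) (ascents st) z → AvoidsAll (word st ++ z) →
               z ∈ gen st (length z)
gen-complete st []      _    _      = here refl
gen-complete st (v ∷ z) tail avoids
  with st′ , succ ← transition-exists st (proj₁ tail) (avoids-⊆ (++⁺ ⊆-refl (refl ∷ minimum z)) avoids)
  = ∈-concatMap⁺ _ (lose succ (∈-map⁺ (v ∷_)
      (gen-complete st′ z (Equivalence.to (transition-tail t) tail)
                          (subst AvoidsAll (transition-word z t) avoids))))
  where t = successor-transition st succ

gen⇔Continuation : ∀ st n {z} → z ∈ gen st n ⇔ Continuation st n z
gen⇔Continuation st n = mk⇔ (gen-sound st n) λ { (refl , tail , avoids) → gen-complete st _ tail avoids }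

successors-distinct : ∀ st → AllPairs (λ e e′ → proj₁ e ≢ proj₁ e′) (successors st)
successors-distinct (zeros a)                 = ((λ ()) ∷ []) ∷ [] ∷ []
successors-distinct (stair a zero zero)       = ((λ ()) ∷ (λ ()) ∷ []) ∷ ((λ ()) ∷ []) ∷ [] ∷ []
successors-distinct (stair a (suc k) zero)    = (1+n≢n ∷ []) ∷ [] ∷ []
successors-distinct (stair a zero (suc j))    = ((λ ()) ∷ []) ∷ [] ∷ []
successors-distinct (stair a (suc k) (suc j)) = [] ∷ []
successors-distinct (valley a b c)            = [] ∷ []

disjoint-heads : ∀ {v v′ : ℕ} {L L′} → v ≢ v′ → Disjoint (map (v ∷_) L) (map (v′ ∷_) L′)
disjoint-heads v≢v′ (x∈ , x∈′) with ∈-map⁻ _ x∈ | ∈-map⁻ _ x∈′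
... | _ , _ , refl | _ , _ , eq = v≢v′ (∷-injectiveˡ eq)

gen-unique : ∀ st n → Unique (gen st n)
gen-unique st zero    = [] ∷ []
gen-unique st (suc n) =
  Unique.concat⁺
    (All.map⁺ (All.universal (λ (_ , st′) → Unique.map⁺ ∷-injectiveʳ (gen-unique st′ n)) (successors st)))
    (AllPairs.map⁺ (AllPairs.map disjoint-heads (successors-distinct st)))

length-gen-suc : ∀ st n → length (gen st (suc n)) ≡ sum (map (λ (_ , st′) → length (gen st′ n)) (successors st))
length-gen-suc st n = go (successors st)
  where
  go : ∀ es → length (concatMap (λ (v , st′) → map (v ∷_) (gen st′ n)) es)
             ≡ sum (map (λ (_ , st′) → length (gen st′ n)) es)
  go []               = refl
  go ((v , st′) ∷ es) = trans (length-++ (map (v ∷_) (gen st′ n))) (cong₂ _+_ (length-map (v ∷_) (gen st′ n)) (go es))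

count-valley : ∀ a b c n → length (gen (valley a b c) n) ≡ 1
count-valley a b c zero    = refl
count-valley a b c (suc n) = trans (length-gen-suc (valley a b c) n) (cong (_+ 0) (count-valley a b (suc c) n))

count-stair-ss : ∀ a k j n → length (gen (stair a (suc k) (suc j)) n) ≡ 1
count-stair-ss a k j zero    = refl
count-stair-ss a k j (suc n) =
  trans (length-gen-suc (stair a (suc k) (suc j)) n) (cong (_+ 0) (count-stair-ss a k (suc j) n))

count-stair-0s : ∀ a j n → length (gen (stair a 0 (suc j)) n) ≡ suc n
count-stair-0s a j zero    = refl
count-stair-0s a j (suc n) =
  trans (length-gen-suc (stair a 0 (suc j)) n)
        (trans (cong₂ _+_ (count-stair-0s a (suc j) n) (cong (_+ 0) (count-valley a (suc j) 0 n))) (+-comm (suc n) 1))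

count-stair-s0 : ∀ a k n → length (gen (stair a (suc k) 0) n) ≡ suc n
count-stair-s0 a k zero    = refl
count-stair-s0 a k (suc n) =
  trans (length-gen-suc (stair a (suc k) 0) n)
        (trans (cong₂ _+_ (count-stair-s0 a (suc k) n) (cong (_+ 0) (count-stair-ss a k 0 n))) (+-comm (suc n) 1))

count-stair-00 : ∀ a n → length (gen (stair a 0 0) n) ≡ suc (n + n)
count-stair-00 a zero    = refl
count-stair-00 a (suc n) =
  trans (length-gen-suc (stair a 0 0) n)
        (trans (cong₂ _+_ (count-stair-s0 a 0 n) (cong₂ _+_ (count-stair-0s a 0 n) (cong (_+ 0) (count-valley a 0 0 n))))
               (arithmetic n))
  where
  arithmetic : ∀ n → suc n + (suc n + (1 + 0)) ≡ suc (suc n + suc n)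
  arithmetic = solve-∀

count-zeros : ∀ a n → length (gen (zeros a) n) ≡ n ^ 2 + 1
count-zeros a zero    = refl
count-zeros a (suc n) =
  trans (length-gen-suc (zeros a) n)
        (trans (cong₂ _+_ (count-zeros (suc a) n) (cong (_+ 0) (count-stair-00 a n))) (arithmetic n))
  where
  arithmetic : ∀ n → (n * (n * 1) + 1) + (suc (n + n) + 0) ≡ suc n * (suc n * 1) + 1
  arithmetic = solve-∀

theorem5p3 : (n : ℕ) → n ≥ 1 →
    HasCard (InA n ((0 ∷ 1 ∷ 0 ∷ 1 ∷ []) ∷ (0 ∷ 1 ∷ 0 ∷ 2 ∷ []) ∷ (0 ∷ 1 ∷ 1 ∷ 2 ∷ []) ∷ (0 ∷ 1 ∷ 2 ∷ 0 ∷ []) ∷ (0 ∷ 1 ∷ 2 ∷ 1 ∷ []) ∷ [])) ((n ∸ 1) ^ 2 + 1)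
theorem5p3 (suc n) _ =
  map (0 ∷_) (gen (zeros 0) n) ,
  Unique.map⁺ ∷-injectiveʳ (gen-unique (zeros 0) n) ,
  (λ x → mk⇔ (sound x) (complete x)) ,
  trans (length-map (0 ∷_) (gen (zeros 0) n)) (count-zeros 0 n)
  where
  sound : ∀ x → x ∈ map (0 ∷_) (gen (zeros 0) n) → InA (suc n) forbidden x
  sound x x∈
    with z , z∈gen , refl ← ∈-map⁻ (0 ∷_) x∈
    with len , tail , avoids ← Equivalence.to (gen⇔Continuation (zeros 0) n) z∈gen
    = cong suc len , (refl , Equivalence.to (IsAscentTail⇔lookup 0 0 z) tail) , avoids
  complete : ∀ x → InA (suc n) forbidden x → x ∈ map (0 ∷_) (gen (zeros 0) n)
  complete (.0 ∷ z) (len , (refl , bounds) , avoids) =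
    ∈-map⁺ (0 ∷_) (Equivalence.from (gen⇔Continuation (zeros 0) n)
      (suc-injective len , Equivalence.from (IsAscentTail⇔lookup 0 0 z) bounds , avoids))
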